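{- Let $n \in \mathbb{Z}$ and $a \geq 0$. If the monomial $x^a$ appears with nonzero coefficient in $\overline{S}_n(x) \in \mathbb{F}_2[x]$, then $v(a) = v(n)$.
   Context: For $n \in \mathbb{Z}$, $S_n \in \mathbb{Z}[x]$ is the unique polynomial with $S_n(x + x^{ -1}) = x^n + x^{ -n}$ (so $S_0 = 2$, $S_1 = x$, $S_{ -n} = S_n$, and $S_n = x S_{n-1} - S_{n-2}$); $\overline{S}_n$ denotes its reduction modulo $2$. $v(\cdot)$ denotes the $2$-adic valuation (with $v(0) = \infty$). -}

module Defs where

open import Data.Nat as ℕ using (ℕ; zero; suc)
open import Data.Nat.DivMod using (_%_; _/_)
open import Data.Integer as ℤ using (ℤ; +_; ∣_∣)
open import Data.List using (List; []; _∷_)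
open import Data.Maybe using (Maybe; just; nothing)
open import Data.Bool using (Bool; true; false; if_then_else_)

-- Polynomials in ℤ[x] as coefficient lists (constant term first).
Poly : Set
Poly = List ℤ

_⊕_ : Poly → Poly → Poly
[] ⊕ q = q
(a ∷ p) ⊕ [] = a ∷ p
(a ∷ p) ⊕ (b ∷ q) = (a ℤ.+ b) ∷ (p ⊕ q)

neg : Poly → Poly
neg [] = []
neg (a ∷ p) = ℤ.- a ∷ neg p

mulX : Poly → Poly
mulX p = + 0 ∷ p

coeff : Poly → ℕ → ℤ
coeff [] _ = + 0
coeff (c ∷ p) zero = c
coeff (c ∷ p) (suc a) = coeff p a

S₀₁ : ℕ → Poly
S₀₁ zero = + 2 ∷ []
S₀₁ (suc zero) = + 0 ∷ + 1 ∷ []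
S₀₁ (suc (suc n)) = mulX (S₀₁ (suc n)) ⊕ neg (S₀₁ n)

-- S_n for n ∈ ℤ, using S_{-n} = S_n
S : ℤ → Poly
S n = S₀₁ ∣ n ∣

-- coefficient of x^a in the reduction of S_n modulo 2 (an element of 𝔽₂ = Bool)
Sbar-coeff : ℤ → ℕ → Bool
Sbar-coeff n a with ∣ coeff (S n) a ∣ % 2
... | zero = false
... | suc _ = true

-- 2-adic valuation on ℕ, with v(0) = ∞ represented as nothing
v-fuel : ℕ → ℕ → ℕ
v-fuel zero m = zero
v-fuel (suc f) m with m % 2
... | suc _ = zero
... | zero = suc (v-fuel f (m / 2))

vℕ : ℕ → Maybe ℕ
vℕ zero = nothing
vℕ (suc m) = just (v-fuel (suc m) (suc m))

v : ℤ → Maybe ℕ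
v n = vℕ ∣ n ∣

-- Modulo 2 the recurrence reads S̄ₙ₊₂ = x S̄ₙ₊₁ + S̄ₙ, which iterates to S̄ₙ₊₄ = x² S̄ₙ₊₂ + S̄ₙ.
-- Induction on n then shows S̄₂ₙ(x) = S̄ₙ(x²) and that S̄₂ₙ₊₁ has only odd-degree terms;
-- with S̄₀ = 0, a monomial x^a of S̄ₙ has a odd exactly when n is odd, and for n = 2m
-- it is a = 2b with x^b a monomial of S̄ₘ, so v(a) = v(n) by strong induction on n.
{-# OPTIONS --safe #-}
module Submission where

open import Defs
open import Data.Nat using (ℕ)
open import Data.Integer using (ℤ; +_)
open import Data.Bool using (true)
open import Relation.Binary.PropositionalEquality using (_≡_)

open import Data.Nat as ℕ using (zero; suc; _*_; _≤_; _<_; z≤n; s≤s)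
open import Data.Nat.DivMod using (_%_; m*n%n≡0; m*n/n≡m; [m+kn]%n≡m%n)
import Data.Nat.Properties as ℕ
open import Data.Nat.Induction using (<-rec)
open import Data.Integer as ℤ using (-[1+_]; _⊖_; ∣_∣)
import Data.Integer.Properties as ℤ
open import Data.Parity.Base using (Parity; 0ℙ; 1ℙ; _+_)
open import Data.Parity.Properties using (+-homo-+; +-assoc; p+p≡0ℙ)
open import Data.List using ([]; _∷_)
open import Data.Maybe using (just; map)
open import Function using (_∘_)
open import Relation.Binary.PropositionalEquality using (refl; sym; trans; cong; cong₂; module ≡-Reasoning)

open ≡-Reasoning

parityℤ : ℤ → Parity
parityℤ = ℕ.parity ∘ ∣_∣

parity-∣⊖∣ : ∀ m n → ℕ.parity ∣ m ⊖ n ∣ ≡ ℕ.parity (m ℕ.+ n)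
parity-∣⊖∣ m zero = cong ℕ.parity (sym (ℕ.+-identityʳ m))
parity-∣⊖∣ zero (suc n) = refl
parity-∣⊖∣ (suc m) (suc n) = begin
  ℕ.parity ∣ suc m ⊖ suc n ∣        ≡⟨ cong parityℤ (ℤ.[1+m]⊖[1+n]≡m⊖n m n) ⟩
  ℕ.parity ∣ m ⊖ n ∣                ≡⟨ parity-∣⊖∣ m n ⟩
  ℕ.parity (suc (suc (m ℕ.+ n)))    ≡⟨ cong ℕ.parity (ℕ.+-suc (suc m) n) ⟨
  ℕ.parity (suc m ℕ.+ suc n)        ∎

parityℤ-+ : ∀ x y → parityℤ (x ℤ.+ y) ≡ parityℤ x + parityℤ y
parityℤ-+ (+ m) (+ n) = +-homo-+ m n
parityℤ-+ (+ m) -[1+ n ] = trans (parity-∣⊖∣ m (suc n)) (+-homo-+ m (suc n))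
parityℤ-+ -[1+ m ] (+ n) =
  trans (parity-∣⊖∣ n (suc m)) (trans (cong ℕ.parity (ℕ.+-comm n (suc m))) (+-homo-+ (suc m) n))
parityℤ-+ -[1+ m ] -[1+ n ] =
  trans (cong ℕ.parity (sym (ℕ.+-suc (suc m) n))) (+-homo-+ (suc m) (suc n))

parityℤ-neg : ∀ x → parityℤ (ℤ.- x) ≡ parityℤ x
parityℤ-neg x = cong ℕ.parity (ℤ.∣-i∣≡∣i∣ x)

-- Polynomials over 𝔽₂, modelled as coefficient sequences with values in Parity.
Poly₂ : Set
Poly₂ = ℕ → Parity

mulX₂ : Poly₂ → Poly₂
mulX₂ p zero = 0ℙ
mulX₂ p (suc a) = p a

mulX₂-cong : ∀ {p q} → (∀ a → p a ≡ q a) → ∀ a → mulX₂ p a ≡ mulX₂ q a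
mulX₂-cong p≗q zero = refl
mulX₂-cong p≗q (suc a) = p≗q a

reduce : Poly → Poly₂
reduce p a = parityℤ (coeff p a)

coeff-⊕ : ∀ p q a → coeff (p ⊕ q) a ≡ coeff p a ℤ.+ coeff q a
coeff-⊕ [] q a = sym (ℤ.+-identityˡ _)
coeff-⊕ (c ∷ p) [] zero = sym (ℤ.+-identityʳ c)
coeff-⊕ (c ∷ p) [] (suc a) = sym (ℤ.+-identityʳ _)
coeff-⊕ (c ∷ p) (d ∷ q) zero = refl
coeff-⊕ (c ∷ p) (d ∷ q) (suc a) = coeff-⊕ p q a

coeff-neg : ∀ p a → coeff (neg p) a ≡ ℤ.- coeff p a
coeff-neg [] a = refl
coeff-neg (c ∷ p) zero = refl
coeff-neg (c ∷ p) (suc a) = coeff-neg p a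

reduce-⊕ : ∀ p q a → reduce (p ⊕ q) a ≡ reduce p a + reduce q a
reduce-⊕ p q a = trans (cong parityℤ (coeff-⊕ p q a)) (parityℤ-+ (coeff p a) (coeff q a))

reduce-neg : ∀ p a → reduce (neg p) a ≡ reduce p a
reduce-neg p a = trans (cong parityℤ (coeff-neg p a)) (parityℤ-neg (coeff p a))

reduce-mulX : ∀ p a → reduce (mulX p) a ≡ mulX₂ (reduce p) a
reduce-mulX p zero = refl
reduce-mulX p (suc a) = refl

S̄ : ℕ → Poly₂
S̄ zero a = 0ℙ
S̄ (suc zero) (suc zero) = 1ℙ
S̄ (suc zero) _ = 0ℙ
S̄ (suc (suc n)) a = mulX₂ (S̄ (suc n)) a + S̄ n a

reduce-S₀₁ : ∀ n a → reduce (S₀₁ n) a ≡ S̄ n a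
reduce-S₀₁ zero zero = refl
reduce-S₀₁ zero (suc a) = refl
reduce-S₀₁ (suc zero) zero = refl
reduce-S₀₁ (suc zero) (suc zero) = refl
reduce-S₀₁ (suc zero) (suc (suc a)) = refl
reduce-S₀₁ (suc (suc n)) a = begin
  reduce (mulX (S₀₁ (suc n)) ⊕ neg (S₀₁ n)) a              ≡⟨ reduce-⊕ (mulX (S₀₁ (suc n))) (neg (S₀₁ n)) a ⟩
  reduce (mulX (S₀₁ (suc n))) a + reduce (neg (S₀₁ n)) a   ≡⟨ cong₂ _+_ (reduce-mulX (S₀₁ (suc n)) a) (reduce-neg (S₀₁ n) a) ⟩
  mulX₂ (reduce (S₀₁ (suc n))) a + reduce (S₀₁ n) a        ≡⟨ cong₂ _+_ (mulX₂-cong (reduce-S₀₁ (suc n)) a) (reduce-S₀₁ n a) ⟩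
  mulX₂ (S̄ (suc n)) a + S̄ n a                              ∎

+-cancel-middle : ∀ p q r → (p + q) + (q + r) ≡ p + r
+-cancel-middle p q r = begin
  (p + q) + (q + r)  ≡⟨ +-assoc p q (q + r) ⟩
  p + (q + (q + r))  ≡⟨ cong (λ s → p + s) (+-assoc q q r) ⟨
  p + ((q + q) + r)  ≡⟨ cong (λ s → p + (s + r)) (p+p≡0ℙ q) ⟩
  p + r              ∎

-- S̄ₙ₊₄ = x S̄ₙ₊₃ + S̄ₙ₊₂ = x² S̄ₙ₊₂ + (S̄ₙ₊₂ + S̄ₙ) + S̄ₙ₊₂, using x S̄ₙ₊₁ = S̄ₙ₊₂ + S̄ₙ.
S̄-x²-recurrence : ∀ n a → S̄ (suc (suc (suc (suc n)))) a ≡ mulX₂ (mulX₂ (S̄ (suc (suc n)))) a + S̄ n a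
S̄-x²-recurrence n zero = refl
S̄-x²-recurrence n (suc a) = +-cancel-middle (mulX₂ (S̄ (suc (suc n))) a) (S̄ (suc n) a) (S̄ n (suc a))

S̄[2n,2a]≡S̄[n,a] : ∀ n a → S̄ (n * 2) (a * 2) ≡ S̄ n a
S̄[2n,2a]≡S̄[n,a] zero a = refl
S̄[2n,2a]≡S̄[n,a] (suc zero) zero = refl
S̄[2n,2a]≡S̄[n,a] (suc zero) (suc zero) = refl
S̄[2n,2a]≡S̄[n,a] (suc zero) (suc (suc a)) = refl
S̄[2n,2a]≡S̄[n,a] (suc (suc n)) zero = trans (S̄-x²-recurrence (n * 2) zero) (S̄[2n,2a]≡S̄[n,a] n zero)
S̄[2n,2a]≡S̄[n,a] (suc (suc n)) (suc a) = trans (S̄-x²-recurrence (n * 2) (suc a * 2))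
  (cong₂ _+_ (S̄[2n,2a]≡S̄[n,a] (suc n) a) (S̄[2n,2a]≡S̄[n,a] n (suc a)))

S̄[2n,2a+1]≡0 : ∀ n a → S̄ (n * 2) (suc (a * 2)) ≡ 0ℙ
S̄[2n,2a+1]≡0 zero a = refl
S̄[2n,2a+1]≡0 (suc zero) zero = refl
S̄[2n,2a+1]≡0 (suc zero) (suc a) = refl
S̄[2n,2a+1]≡0 (suc (suc n)) zero = trans (S̄-x²-recurrence (n * 2) 1) (S̄[2n,2a+1]≡0 n zero)
S̄[2n,2a+1]≡0 (suc (suc n)) (suc a) = trans (S̄-x²-recurrence (n * 2) (suc (suc a * 2)))
  (cong₂ _+_ (S̄[2n,2a+1]≡0 (suc n) a) (S̄[2n,2a+1]≡0 n (suc a)))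

S̄[2n+1,2a]≡0 : ∀ n a → S̄ (suc (n * 2)) (a * 2) ≡ 0ℙ
S̄[2n+1,2a]≡0 zero zero = refl
S̄[2n+1,2a]≡0 zero (suc a) = refl
S̄[2n+1,2a]≡0 (suc zero) zero = refl
S̄[2n+1,2a]≡0 (suc zero) (suc zero) = refl
S̄[2n+1,2a]≡0 (suc zero) (suc (suc a)) = refl
S̄[2n+1,2a]≡0 (suc (suc n)) zero = trans (S̄-x²-recurrence (suc (n * 2)) zero) (S̄[2n+1,2a]≡0 n zero)
S̄[2n+1,2a]≡0 (suc (suc n)) (suc a) = trans (S̄-x²-recurrence (suc (n * 2)) (suc a * 2))
  (cong₂ _+_ (S̄[2n+1,2a]≡0 (suc n) a) (S̄[2n+1,2a]≡0 n (suc a)))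

data EvenOdd : ℕ → Set where
  even : ∀ k → EvenOdd (k * 2)
  odd  : ∀ k → EvenOdd (suc (k * 2))

evenOdd : ∀ n → EvenOdd n
evenOdd zero = even 0
evenOdd (suc n) with evenOdd n
... | even k = odd k
... | odd k = even (suc k)

v-fuel-odd : ∀ f k → v-fuel (suc f) (suc (k * 2)) ≡ 0
v-fuel-odd f k with suc (k * 2) % 2 | [m+kn]%n≡m%n 1 k 2
... | _ | refl = refl

v-fuel-even : ∀ f k → v-fuel (suc f) (k * 2) ≡ suc (v-fuel f k)
v-fuel-even f k with k * 2 % 2 | m*n%n≡0 k 2
... | _ | refl = cong (suc ∘ v-fuel f) (m*n/n≡m k 2)

v-fuel-irrelevant : ∀ {m} f g → 0 < m → m ≤ f → m ≤ g → v-fuel f m ≡ v-fuel g m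
v-fuel-irrelevant zero g 0<m m≤0 _ with () ← ℕ.<-≤-trans 0<m m≤0
v-fuel-irrelevant (suc f) zero 0<m _ m≤0 with () ← ℕ.<-≤-trans 0<m m≤0
v-fuel-irrelevant {m} (suc f) (suc g) 0<m m≤f m≤g with evenOdd m
v-fuel-irrelevant (suc f) (suc g) () _ _ | even zero
... | odd k = trans (v-fuel-odd f k) (sym (v-fuel-odd g k))
... | even (suc k) = begin
  v-fuel (suc f) (suc k * 2)   ≡⟨ v-fuel-even f (suc k) ⟩
  suc (v-fuel f (suc k))       ≡⟨ cong suc (v-fuel-irrelevant f g (s≤s z≤n) (half m≤f) (half m≤g)) ⟩
  suc (v-fuel g (suc k))       ≡⟨ v-fuel-even g (suc k) ⟨
  v-fuel (suc g) (suc k * 2)   ∎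
  where
  half : ∀ {h} → suc k * 2 ≤ suc h → suc k ≤ h
  half (s≤s k*2<h) = ℕ.≤-trans (s≤s (ℕ.m≤m*n k 2)) k*2<h

vℕ[2k+1]≡0 : ∀ k → vℕ (suc (k * 2)) ≡ just 0
vℕ[2k+1]≡0 k = cong just (v-fuel-odd (k * 2) k)

vℕ[2k]≡1+vℕ[k] : ∀ k → vℕ (k * 2) ≡ map suc (vℕ k)
vℕ[2k]≡1+vℕ[k] zero = refl
vℕ[2k]≡1+vℕ[k] (suc k) = cong just (begin
  v-fuel (suc (suc (k * 2))) (suc k * 2)   ≡⟨ v-fuel-even (suc (k * 2)) (suc k) ⟩
  suc (v-fuel (suc (k * 2)) (suc k))       ≡⟨ cong suc (v-fuel-irrelevant (suc (k * 2)) (suc k) (s≤s z≤n) k+1≤2k+1 ℕ.≤-refl) ⟩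
  suc (v-fuel (suc k) (suc k))             ∎)
  where
  k+1≤2k+1 : suc k ≤ suc (k * 2)
  k+1≤2k+1 = s≤s (ℕ.m≤m*n k 2)

S̄[n,a]≡1⇒vℕ[a]≡vℕ[n] : ∀ n a → S̄ n a ≡ 1ℙ → vℕ a ≡ vℕ n
S̄[n,a]≡1⇒vℕ[a]≡vℕ[n] = <-rec _ step
  where
  step : ∀ n → (∀ {m} → m < n → ∀ a → S̄ m a ≡ 1ℙ → vℕ a ≡ vℕ m) → ∀ a → S̄ n a ≡ 1ℙ → vℕ a ≡ vℕ n
  step n rec a S̄≡1 with evenOdd n | evenOdd a
  ... | odd k | odd b = trans (vℕ[2k+1]≡0 b) (sym (vℕ[2k+1]≡0 k))
  ... | odd k | even b with () ← trans (sym (S̄[2n+1,2a]≡0 k b)) S̄≡1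
  ... | even k | odd b with () ← trans (sym (S̄[2n,2a+1]≡0 k b)) S̄≡1
  ... | even zero | even b with () ← S̄≡1
  ... | even (suc k) | even b = begin
    vℕ (b * 2)             ≡⟨ vℕ[2k]≡1+vℕ[k] b ⟩
    map suc (vℕ b)         ≡⟨ cong (map suc) (rec k+1<2k+2 b S̄[k+1,b]≡1) ⟩
    map suc (vℕ (suc k))   ≡⟨ vℕ[2k]≡1+vℕ[k] (suc k) ⟨
    vℕ (suc k * 2)         ∎
    where
    k+1<2k+2 : suc k < suc k * 2
    k+1<2k+2 = ℕ.m<m*n (suc k) 2 ℕ.≤-refl

    S̄[k+1,b]≡1 : S̄ (suc k) b ≡ 1ℙ
    S̄[k+1,b]≡1 = trans (sym (S̄[2n,2a]≡S̄[n,a] (suc k) b)) S̄≡1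

%2≡suc⇒parity≡1ℙ : ∀ m {r} → m % 2 ≡ suc r → ℕ.parity m ≡ 1ℙ
%2≡suc⇒parity≡1ℙ zero ()
%2≡suc⇒parity≡1ℙ (suc zero) _ = refl
%2≡suc⇒parity≡1ℙ (suc (suc m)) m%2≡1+r = %2≡suc⇒parity≡1ℙ m m%2≡1+r

Sbar-coeff≡true⇒reduce≡1ℙ : ∀ n a → Sbar-coeff n a ≡ true → reduce (S n) a ≡ 1ℙ
Sbar-coeff≡true⇒reduce≡1ℙ n a h with ∣ coeff (S n) a ∣ % 2 in eq
... | zero with () ← h
... | suc r = %2≡suc⇒parity≡1ℙ ∣ coeff (S n) a ∣ eq

corollary5p2 : (n : ℤ) (a : ℕ) → Sbar-coeff n a ≡ true → v (+ a) ≡ v n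
corollary5p2 n a h = S̄[n,a]≡1⇒vℕ[a]≡vℕ[n] ∣ n ∣ a (begin
  S̄ ∣ n ∣ a        ≡⟨ reduce-S₀₁ ∣ n ∣ a ⟨
  reduce (S n) a   ≡⟨ Sbar-coeff≡true⇒reduce≡1ℙ n a h ⟩
  1ℙ               ∎)
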